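{- For every $\epsilon>0$ there is a principal-agent instance with $n=2$ actions and $m=2$ items in which the best separable (exactly IC) contract only provides a $(2-\epsilon)$-approximation to $OPT$, i.e. $OPT/ALG\ge 2-\epsilon$, where $ALG$ is the maximum expected payoff to the principal over separable contracts and $OPT$ is the maximum expected payoff over all contracts.
   Context: A principal-agent setting consists of an item set $M=\{1,\dots,m\}$ with rewards $r_j\ge0$; $n$ actions $a_1,\dots,a_n$ with costs $0=c_1\le\dots\le c_n$; and for each action $a_i$ probabilities $q_{i,1},\dots,q_{i,m}\in[0,1]$; action $a_i$ induces outcome $S\subseteq M$ with probability $q_{i,S}=\prod_{j\in S}q_{i,j}\prod_{j\notin S}(1-q_{i,j})$. $r_S=\sum_{j\in S}r_j$, $R_i=\sum_jq_{i,j}r_j$. A contract is a vector $p=(p_S)_{S\subseteq M}$ of nonnegative payments; $p_i=\sum_Sq_{i,S}p_S$; the agent's utility from $a_i$ is $p_i-c_i$ and the principal's payoff is $R_i-p_i$. Action $a_i$ is IC under $p$ if $p_i-c_i\ge p_{i'}-c_{i'}$ for all $i'$; among IC actions the agent picks one maximizing the principal's payoff, which gives the contract's expected payoff. A contract is separable if there are $p_1,\dots,p_m\ge0$ with $p_S=\sum_{j\in S}p_j$ for every $S\subseteq M$.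
   Formalization: The parameter ε and the contract payments $p_S$ are rational, and the instance's rewards, costs and probabilities are taken in ℚ. -}

module Defs where

open import Data.Nat using (ℕ; zero; suc)
open import Data.Fin as Fin using (Fin; zero; suc; toℕ)
open import Data.Unit using (⊤)
open import Data.Bool using (Bool; true; false; if_then_else_)
open import Data.Vec using (Vec; []; _∷_; lookup)
open import Data.List using (List; []; _∷_; map; _++_; foldr)
open import Data.Rational using (ℚ; 0ℚ; 1ℚ; _+_; _*_; _-_; _≤_)
open import Data.Product using (Σ; ∃; _×_; _,_)
open import Relation.Binary.PropositionalEquality using (_≡_)

-- Outcomes: subsets S ⊆ M = Fin m, as characteristic vectors.
Outcome : ℕ → Set
Outcome m = Vec Bool m

allOutcomes : (m : ℕ) → List (Outcome m)
allOutcomes zero    = [] ∷ []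
allOutcomes (suc m) = map (false ∷_) (allOutcomes m) ++ map (true ∷_) (allOutcomes m)

sumFin : (m : ℕ) → (Fin m → ℚ) → ℚ
sumFin zero    f = 0ℚ
sumFin (suc m) f = f zero + sumFin m (λ j → f (suc j))

prodFin : (m : ℕ) → (Fin m → ℚ) → ℚ
prodFin zero    f = 1ℚ
prodFin (suc m) f = f zero * prodFin m (λ j → f (suc j))

sumList : {A : Set} → (A → ℚ) → List A → ℚ
sumList f = foldr (λ x acc → f x + acc) 0ℚ

record Instance (m n : ℕ) : Set where
  field
    reward : Fin m → ℚ
    cost   : Fin n → ℚ
    prob   : Fin n → Fin m → ℚ
    reward-nonneg : ∀ j → 0ℚ ≤ reward j
    cost-first    : (i : Fin n) → toℕ i ≡ 0 → cost i ≡ 0ℚ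
    cost-sorted   : (i i' : Fin n) → i Fin.≤ i' → cost i ≤ cost i'
    prob-lo       : ∀ i j → 0ℚ ≤ prob i j
    prob-hi       : ∀ i j → prob i j ≤ 1ℚ

Contract : ℕ → Set
Contract m = Outcome m → ℚ

Nonneg : {m : ℕ} → Contract m → Set
Nonneg {m} p = ∀ S → 0ℚ ≤ p S

module _ {m n : ℕ} (I : Instance m n) where
  open Instance I

  outcomeProb : Fin n → Outcome m → ℚ
  outcomeProb i S = prodFin m (λ j → if lookup S j then prob i j else 1ℚ - prob i j)

  expReward : Fin n → ℚ
  expReward i = sumFin m (λ j → prob i j * reward j)

  expPay : Contract m → Fin n → ℚ
  expPay p i = sumList (λ S → outcomeProb i S * p S) (allOutcomes m)

  IC : Contract m → Fin n → Set
  IC p i = ∀ i' → expPay p i' - cost i' ≤ expPay p i - cost i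

  -- v is the principal's expected payoff under p: the maximum of R_i - p_i
  -- over IC actions i (tie-breaking in favour of the principal).
  IsPayoff : Contract m → ℚ → Set
  IsPayoff p v = (Σ (Fin n) λ i → IC p i × (expReward i - expPay p i ≡ v))
               × (∀ i → IC p i → expReward i - expPay p i ≤ v)

  IsMaxPayoffOver : (Contract m → Set) → ℚ → Set
  IsMaxPayoffOver P v = (Σ (Contract m) λ p → Nonneg p × P p × IsPayoff p v)
                      × (∀ p w → Nonneg p → P p → IsPayoff p w → w ≤ v)

AnyContract : {m : ℕ} → Contract m → Set
AnyContract _ = ⊤

Separable : {m : ℕ} → Contract m → Set
Separable {m} p = Σ (Fin m → ℚ) λ w → (∀ j → 0ℚ ≤ w j)
                  × (∀ S → p S ≡ sumFin m (λ j → if lookup S j then w j else 0ℚ))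

-- Two items with rewards 0 and 1 and two actions: the free action yields item 0
-- surely and item 1 with probability s, the action of cost (1 − s)² yields item 1
-- surely. Paying (1 − s)² exactly on the outcome {1} implements the costly action
-- and earns OPT = 1 − (1 − s)² = s(2 − s). A separable contract cannot tell {1}
-- from {0, 1}, so under the free action the agent also collects the weight w₁ of
-- item 1 with probability s; incentive compatibility of the costly action then
-- forces w₁ ≥ 1 − s, whence ALG = s. So OPT / ALG = 2 − s, and we take s ≤ ε.
module Submission where

open import Defs
open import Data.Rational using (ℚ; 0ℚ; 1ℚ; ½; _+_; _*_; _-_; -_; _≤_; _<_; Positive; positive; nonNegative)
open import Data.Rational.Properties
  using ( _≟_; +-*-commutativeRing; ≤-refl; ≤-reflexive; ≤-trans; ≤-total; <⇒≤; ≤-<-trans; _<?_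
        ; +-mono-≤; +-monoˡ-≤; +-monoʳ-≤; +-monoˡ-<; +-inverseʳ; +-identityˡ; *-zeroʳ
        ; neg-antimono-≤; *-monoˡ-≤-nonNeg; *-cancelˡ-≤-pos; positive⁻¹; nonNegative⁻¹ )
open import Data.Bool using (true; false; if_then_else_)
open import Data.Fin using (Fin; zero; suc)
open import Data.List using (List; []; _∷_)
open import Data.Nat using (ℕ; zero; suc)
open import Data.Product using (Σ; _×_; _,_)
open import Data.Sum using (inj₁; inj₂)
open import Data.Vec using ([]; _∷_; lookup)
open import Relation.Binary.PropositionalEquality
  using (_≡_; refl; sym; trans; cong; cong₂; subst; subst₂; module ≡-Reasoning)
open import Relation.Nullary.Decidable using (toWitness; dec⇒maybe)
open import Tactic.RingSolver using (solve-∀)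
open import Tactic.RingSolver.Core.AlmostCommutativeRing using (AlmostCommutativeRing; fromCommutativeRing)

ℚ-ring : AlmostCommutativeRing _ _
ℚ-ring = fromCommutativeRing +-*-commutativeRing (λ x → dec⇒maybe (0ℚ ≟ x))

p≤q⇒0≤q-p : ∀ {p q} → p ≤ q → 0ℚ ≤ q - p
p≤q⇒0≤q-p {p} {q} p≤q = subst (_≤ q - p) (+-inverseʳ p) (+-monoˡ-≤ (- p) p≤q)

p<q⇒0<q-p : ∀ {p q} → p < q → 0ℚ < q - p
p<q⇒0<q-p {p} {q} p<q = subst (_< q - p) (+-inverseʳ p) (+-monoˡ-< (- p) p<q)

≤-fromGap : ∀ {p q g} → 0ℚ ≤ g → g ≡ q - p → p ≤ q
≤-fromGap {p} {q} 0≤g refl = subst₂ _≤_ (+-identityˡ p) (q-p+p≡q q p) (+-monoˡ-≤ p 0≤g)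
  where
  q-p+p≡q : ∀ q p → (q - p) + p ≡ q
  q-p+p≡q = solve-∀ ℚ-ring

p-0≡p : ∀ p → p - 0ℚ ≡ p
p-0≡p = solve-∀ ℚ-ring

0≤1 : 0ℚ ≤ 1ℚ
0≤1 = nonNegative⁻¹ 1ℚ

0≤+ : ∀ {p q} → 0ℚ ≤ p → 0ℚ ≤ q → 0ℚ ≤ p + q
0≤+ = +-mono-≤

0≤* : ∀ {p q} → 0ℚ ≤ p → 0ℚ ≤ q → 0ℚ ≤ p * q
0≤* {p} {q} 0≤p 0≤q = subst (_≤ p * q) (*-zeroʳ p) (*-monoˡ-≤-nonNeg p {{nonNegative 0≤p}} 0≤q)

prodFin-nonneg : ∀ m (f : Fin m → ℚ) → (∀ j → 0ℚ ≤ f j) → 0ℚ ≤ prodFin m f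
prodFin-nonneg zero    f _   = 0≤1
prodFin-nonneg (suc m) f f≥0 = 0≤* (f≥0 zero) (prodFin-nonneg m _ (λ j → f≥0 (suc j)))

sumFin-nonneg : ∀ m (f : Fin m → ℚ) → (∀ j → 0ℚ ≤ f j) → 0ℚ ≤ sumFin m f
sumFin-nonneg zero    f _   = ≤-refl
sumFin-nonneg (suc m) f f≥0 = 0≤+ (f≥0 zero) (sumFin-nonneg m _ (λ j → f≥0 (suc j)))

sumList-nonneg : ∀ {A : Set} (f : A → ℚ) (xs : List A) → (∀ x → 0ℚ ≤ f x) → 0ℚ ≤ sumList f xs
sumList-nonneg f []       _   = ≤-refl
sumList-nonneg f (x ∷ xs) f≥0 = 0≤+ (f≥0 x) (sumList-nonneg f xs f≥0)

separableContract : ∀ {m} → (Fin m → ℚ) → Contract m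
separableContract {m} w S = sumFin m (λ j → if lookup S j then w j else 0ℚ)

module _ {m} {w : Fin m → ℚ} (w≥0 : ∀ j → 0ℚ ≤ w j) where

  separableContract-nonneg : Nonneg (separableContract w)
  separableContract-nonneg S = sumFin-nonneg m _ term-nonneg
    where
    term-nonneg : ∀ j → 0ℚ ≤ (if lookup S j then w j else 0ℚ)
    term-nonneg j with lookup S j
    ... | true  = w≥0 j
    ... | false = ≤-refl

  separableContract-separable : Separable (separableContract w)
  separableContract-separable = w , w≥0 , λ S → refl

module _ {m n : ℕ} (I : Instance m n) where
  open Instance I

  outcomeProb-nonneg : ∀ i S → 0ℚ ≤ outcomeProb I i S
  outcomeProb-nonneg i S = prodFin-nonneg m _ factor-nonneg
    where
    factor-nonneg : ∀ j → 0ℚ ≤ (if lookup S j then prob i j else 1ℚ - prob i j)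
    factor-nonneg j with lookup S j
    ... | true  = prob-lo i j
    ... | false = p≤q⇒0≤q-p (prob-hi i j)

  expPay-nonneg : ∀ {p} → Nonneg p → ∀ i → 0ℚ ≤ expPay I p i
  expPay-nonneg p≥0 i =
    sumList-nonneg _ (allOutcomes m) (λ S → 0≤* (outcomeProb-nonneg i S) (p≥0 S))

-- Limited liability: the free first action guarantees the agent a nonnegative
-- utility, so an implemented action is paid at least its cost.
module _ {m n : ℕ} (I : Instance m (suc n)) where
  open Instance I

  IC⇒cost≤expPay : ∀ {p i} → Nonneg p → IC I p i → cost i ≤ expPay I p i
  IC⇒cost≤expPay {p} {i} p≥0 ic = ≤-fromGap 0≤utility refl
    where
    utility₀≡expPay₀ : expPay I p zero - cost zero ≡ expPay I p zero
    utility₀≡expPay₀ rewrite cost-first zero refl = p-0≡p _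
    0≤utility : 0ℚ ≤ expPay I p i - cost i
    0≤utility = ≤-trans (expPay-nonneg I p≥0 zero) (subst (_≤ expPay I p i - cost i) utility₀≡expPay₀ (ic zero))

  payoff≤welfare : ∀ {p i} → Nonneg p → IC I p i →
                   expReward I i - expPay I p i ≤ expReward I i - cost i
  payoff≤welfare {i = i} p≥0 ic = +-monoʳ-≤ (expReward I i) (neg-antimono-≤ (IC⇒cost≤expPay p≥0 ic))

  payoff≤maxWelfare : ∀ {p v} W → Nonneg p → (∀ i → expReward I i - cost i ≤ W) →
                      IsPayoff I p v → v ≤ W
  payoff≤maxWelfare W p≥0 welfare≤W ((i , ic , refl) , _) =
    ≤-trans (payoff≤welfare p≥0 ic) (welfare≤W i)

indifferent⇒IC : ∀ {m} (I : Instance m 2) p →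
                 expPay I p zero - Instance.cost I zero ≡ expPay I p (suc zero) - Instance.cost I (suc zero) →
                 ∀ i → IC I p i
indifferent⇒IC I p indifferent zero       zero       = ≤-refl
indifferent⇒IC I p indifferent zero       (suc zero) = ≤-reflexive (sym indifferent)
indifferent⇒IC I p indifferent (suc zero) zero       = ≤-reflexive indifferent
indifferent⇒IC I p indifferent (suc zero) (suc zero) = ≤-refl

none only₀ only₁ both : Outcome 2
none  = false ∷ false ∷ []
only₀ = true  ∷ false ∷ []
only₁ = false ∷ true  ∷ []
both  = true  ∷ true  ∷ []

expPay-twoItems : ∀ {n} (I : Instance 2 n) p i →
  let q₀ = Instance.prob I i zero ; q₁ = Instance.prob I i (suc zero) in
  expPay I p i ≡ (1ℚ - q₀) * (1ℚ - q₁) * p none + (1ℚ - q₀) * q₁ * p only₁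
               + q₀ * (1ℚ - q₁) * p only₀ + q₀ * q₁ * p both
expPay-twoItems I p i =
  expand (Instance.prob I i zero) (Instance.prob I i (suc zero)) (p none) (p only₁) (p only₀) (p both)
  where
  expand : ∀ q₀ q₁ a b c d →
    (1ℚ - q₀) * ((1ℚ - q₁) * 1ℚ) * a + ((1ℚ - q₀) * (q₁ * 1ℚ) * b
      + (q₀ * ((1ℚ - q₁) * 1ℚ) * c + (q₀ * (q₁ * 1ℚ) * d + 0ℚ)))
    ≡ (1ℚ - q₀) * (1ℚ - q₁) * a + (1ℚ - q₀) * q₁ * b + q₀ * (1ℚ - q₁) * c + q₀ * q₁ * d
  expand = solve-∀ ℚ-ring

module GapInstance (s : ℚ) (0<s : 0ℚ < s) (s<1 : s < 1ℚ) where

  0≤s : 0ℚ ≤ s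
  0≤s = <⇒≤ 0<s

  0≤1-s : 0ℚ ≤ 1ℚ - s
  0≤1-s = p≤q⇒0≤q-p (<⇒≤ s<1)

  cost₁ : ℚ
  cost₁ = (1ℚ - s) * (1ℚ - s)

  reward : Fin 2 → ℚ
  reward zero       = 0ℚ
  reward (suc zero) = 1ℚ

  cost : Fin 2 → ℚ
  cost zero       = 0ℚ
  cost (suc zero) = cost₁

  prob : Fin 2 → Fin 2 → ℚ
  prob zero       zero       = 1ℚ
  prob zero       (suc zero) = s
  prob (suc zero) zero       = 0ℚ
  prob (suc zero) (suc zero) = 1ℚ

  gapInstance : Instance 2 2
  gapInstance = record
    { reward = reward ; cost = cost ; prob = prob
    ; reward-nonneg = λ { zero → ≤-refl ; (suc zero) → 0≤1 }
    ; cost-first    = λ { zero _ → refl ; (suc zero) () }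
    ; cost-sorted   = λ { zero zero _ → ≤-refl ; zero (suc zero) _ → 0≤* 0≤1-s 0≤1-s
                        ; (suc zero) (suc zero) _ → ≤-refl ; (suc zero) zero () }
    ; prob-lo = λ { zero zero → 0≤1 ; zero (suc zero) → 0≤s
                  ; (suc zero) zero → ≤-refl ; (suc zero) (suc zero) → 0≤1 }
    ; prob-hi = λ { zero zero → ≤-refl ; zero (suc zero) → <⇒≤ s<1
                  ; (suc zero) zero → 0≤1 ; (suc zero) (suc zero) → ≤-refl }
    }

  pay₀ : ∀ p → expPay gapInstance p zero ≡ s * p both + (1ℚ - s) * p only₀
  pay₀ p = trans (expPay-twoItems gapInstance p zero) (simplify s (p none) (p only₁) (p only₀) (p both))
    where
    simplify : ∀ s a b c d → (1ℚ - 1ℚ) * (1ℚ - s) * a + (1ℚ - 1ℚ) * s * b + 1ℚ * (1ℚ - s) * c + 1ℚ * s * d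
                           ≡ s * d + (1ℚ - s) * c
    simplify = solve-∀ ℚ-ring

  pay₁ : ∀ p → expPay gapInstance p (suc zero) ≡ p only₁
  pay₁ p = trans (expPay-twoItems gapInstance p (suc zero)) (simplify (p none) (p only₁) (p only₀) (p both))
    where
    simplify : ∀ a b c d → (1ℚ - 0ℚ) * (1ℚ - 1ℚ) * a + (1ℚ - 0ℚ) * 1ℚ * b + 0ℚ * (1ℚ - 1ℚ) * c + 0ℚ * 1ℚ * d ≡ b
    simplify = solve-∀ ℚ-ring

  welfare₀ : expReward gapInstance zero - 0ℚ ≡ s
  welfare₀ = simplify s
    where
    simplify : ∀ s → 1ℚ * 0ℚ + (s * 1ℚ + 0ℚ) - 0ℚ ≡ s
    simplify = solve-∀ ℚ-ring

  s≤welfare₁ : s ≤ 1ℚ - cost₁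
  s≤welfare₁ = ≤-fromGap (0≤* 0≤s 0≤1-s) (gap s)
    where
    gap : ∀ s → s * (1ℚ - s) ≡ (1ℚ - (1ℚ - s) * (1ℚ - s)) - s
    gap = solve-∀ ℚ-ring

  isPayoff-costly : ∀ {p v} → Nonneg p → (∀ i → IC gapInstance p i) →
                    1ℚ - p only₁ ≡ v → s ≤ v → IsPayoff gapInstance p v
  isPayoff-costly {p} {v} p≥0 ic payoff₁≡v s≤v =
    (suc zero , ic (suc zero) , payoff₁)
    , λ { zero ic₀ → ≤-trans (payoff≤welfare gapInstance {i = zero} p≥0 ic₀) (≤-trans (≤-reflexive welfare₀) s≤v)
        ; (suc zero) _ → ≤-reflexive payoff₁ }
    where
    payoff₁ : 1ℚ - expPay gapInstance p (suc zero) ≡ v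
    payoff₁ = trans (cong (λ x → 1ℚ - x) (pay₁ p)) payoff₁≡v

  optContract : Contract 2
  optContract (false ∷ true ∷ []) = cost₁
  optContract (false ∷ false ∷ []) = 0ℚ
  optContract (true ∷ _ ∷ [])      = 0ℚ

  optContract-nonneg : Nonneg optContract
  optContract-nonneg (false ∷ true ∷ []) = 0≤* 0≤1-s 0≤1-s
  optContract-nonneg (false ∷ false ∷ []) = ≤-refl
  optContract-nonneg (true ∷ _ ∷ [])      = ≤-refl

  optContract-indifferent :
    expPay gapInstance optContract zero - 0ℚ ≡ expPay gapInstance optContract (suc zero) - cost₁
  optContract-indifferent = begin
    expPay gapInstance optContract zero - 0ℚ          ≡⟨ cong (_- 0ℚ) (pay₀ optContract) ⟩
    s * 0ℚ + (1ℚ - s) * 0ℚ - 0ℚ                       ≡⟨ bothZero s cost₁ ⟩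
    cost₁ - cost₁                                      ≡⟨ cong (_- cost₁) (sym (pay₁ optContract)) ⟩
    expPay gapInstance optContract (suc zero) - cost₁ ∎
    where
    open ≡-Reasoning
    bothZero : ∀ s c → s * 0ℚ + (1ℚ - s) * 0ℚ - 0ℚ ≡ c - c
    bothZero = solve-∀ ℚ-ring

  optimum : IsMaxPayoffOver gapInstance AnyContract (1ℚ - cost₁)
  optimum =
    ( optContract , optContract-nonneg , _
    , isPayoff-costly optContract-nonneg (indifferent⇒IC gapInstance optContract optContract-indifferent)
                      refl s≤welfare₁ )
    , λ p v p≥0 _ → payoff≤maxWelfare gapInstance (1ℚ - cost₁) p≥0 welfare≤welfare₁
    where
    welfare≤welfare₁ : ∀ i → expReward gapInstance i - cost i ≤ 1ℚ - cost₁
    welfare≤welfare₁ zero       = subst (_≤ 1ℚ - cost₁) (sym welfare₀) s≤welfare₁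
    welfare≤welfare₁ (suc zero) = ≤-refl

  sepWeights : Fin 2 → ℚ
  sepWeights zero       = 0ℚ
  sepWeights (suc zero) = 1ℚ - s

  sepWeights-nonneg : ∀ j → 0ℚ ≤ sepWeights j
  sepWeights-nonneg zero       = ≤-refl
  sepWeights-nonneg (suc zero) = 0≤1-s

  sepContract : Contract 2
  sepContract = separableContract sepWeights

  sepContract-indifferent :
    expPay gapInstance sepContract zero - 0ℚ ≡ expPay gapInstance sepContract (suc zero) - cost₁
  sepContract-indifferent = begin
    expPay gapInstance sepContract zero - 0ℚ                             ≡⟨ cong (_- 0ℚ) (pay₀ sepContract) ⟩
    s * (0ℚ + ((1ℚ - s) + 0ℚ)) + (1ℚ - s) * (0ℚ + (0ℚ + 0ℚ)) - 0ℚ       ≡⟨ bothEqual s ⟩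
    (0ℚ + ((1ℚ - s) + 0ℚ)) - (1ℚ - s) * (1ℚ - s)                         ≡⟨ cong (_- cost₁) (sym (pay₁ sepContract)) ⟩
    expPay gapInstance sepContract (suc zero) - cost₁                    ∎
    where
    open ≡-Reasoning
    bothEqual : ∀ s → s * (0ℚ + ((1ℚ - s) + 0ℚ)) + (1ℚ - s) * (0ℚ + (0ℚ + 0ℚ)) - 0ℚ
                    ≡ (0ℚ + ((1ℚ - s) + 0ℚ)) - (1ℚ - s) * (1ℚ - s)
    bothEqual = solve-∀ ℚ-ring

  module _ {p : Contract 2} (w : Fin 2 → ℚ) (p≡ : ∀ S → p S ≡ separableContract w S) where
    open ≡-Reasoning

    separablePay₀ : expPay gapInstance p zero ≡ w zero + s * w (suc zero)
    separablePay₀ = begin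
      expPay gapInstance p zero                                     ≡⟨ pay₀ p ⟩
      s * p both + (1ℚ - s) * p only₀                               ≡⟨ cong₂ (λ a b → s * a + (1ℚ - s) * b) (p≡ both) (p≡ only₀) ⟩
      s * (w zero + (w (suc zero) + 0ℚ)) + (1ℚ - s) * (w zero + (0ℚ + 0ℚ)) ≡⟨ simplify s (w zero) (w (suc zero)) ⟩
      w zero + s * w (suc zero)                                     ∎
      where
      simplify : ∀ s w₀ w₁ → s * (w₀ + (w₁ + 0ℚ)) + (1ℚ - s) * (w₀ + (0ℚ + 0ℚ)) ≡ w₀ + s * w₁
      simplify = solve-∀ ℚ-ring

    separablePay₁ : expPay gapInstance p (suc zero) ≡ w (suc zero)
    separablePay₁ = trans (trans (pay₁ p) (p≡ only₁)) (simplify (w (suc zero)))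
      where
      simplify : ∀ w₁ → 0ℚ + (w₁ + 0ℚ) ≡ w₁
      simplify = solve-∀ ℚ-ring

  -- Dividing (1 − s) w₁ − (1 − s)² ≥ w₀ ≥ 0 by 1 − s > 0.
  costlyIC⇒1-s≤w₁ : ∀ {w₀ w₁} → 0ℚ ≤ w₀ → w₀ + s * w₁ - 0ℚ ≤ w₁ - cost₁ → 1ℚ - s ≤ w₁
  costlyIC⇒1-s≤w₁ {w₀} {w₁} 0≤w₀ ic =
    *-cancelˡ-≤-pos (1ℚ - s) {{positive (p<q⇒0<q-p s<1)}}
      (≤-fromGap (0≤+ (p≤q⇒0≤q-p ic) 0≤w₀) (gap s w₀ w₁))
    where
    gap : ∀ s w₀ w₁ → ((w₁ - (1ℚ - s) * (1ℚ - s)) - (w₀ + s * w₁ - 0ℚ)) + w₀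
                    ≡ (1ℚ - s) * w₁ - (1ℚ - s) * (1ℚ - s)
    gap = solve-∀ ℚ-ring

  separable-payoff≤s : ∀ p v → Nonneg p → Separable p → IsPayoff gapInstance p v → v ≤ s
  separable-payoff≤s p v p≥0 _ ((zero , ic , refl) , _) =
    ≤-trans (payoff≤welfare gapInstance {i = zero} p≥0 ic) (≤-reflexive welfare₀)
  separable-payoff≤s p v p≥0 (w , w≥0 , p≡) ((suc zero , ic , refl) , _) =
    subst (λ x → 1ℚ - x ≤ s) (sym (separablePay₁ w p≡)) 1-w₁≤s
    where
    1-s≤w₁ : 1ℚ - s ≤ w (suc zero)
    1-s≤w₁ = costlyIC⇒1-s≤w₁ (w≥0 zero)
               (subst₂ _≤_ (cong (_- 0ℚ) (separablePay₀ w p≡)) (cong (_- cost₁) (separablePay₁ w p≡)) (ic zero))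
    gap : ∀ s w₁ → w₁ - (1ℚ - s) ≡ s - (1ℚ - w₁)
    gap = solve-∀ ℚ-ring
    1-w₁≤s : 1ℚ - w (suc zero) ≤ s
    1-w₁≤s = ≤-fromGap (p≤q⇒0≤q-p 1-s≤w₁) (gap s (w (suc zero)))

  separableOptimum : IsMaxPayoffOver gapInstance Separable s
  separableOptimum =
    ( sepContract , separableContract-nonneg sepWeights-nonneg , separableContract-separable sepWeights-nonneg
    , isPayoff-costly (separableContract-nonneg sepWeights-nonneg)
                      (indifferent⇒IC gapInstance sepContract sepContract-indifferent)
                      (oneMinusWeight s) ≤-refl )
    , separable-payoff≤s
    where
    oneMinusWeight : ∀ s → 1ℚ - (0ℚ + ((1ℚ - s) + 0ℚ)) ≡ s
    oneMinusWeight = solve-∀ ℚ-ring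

½<1 : ½ < 1ℚ
½<1 = toWitness {a? = ½ <? 1ℚ} _

∃0<s<1∧s≤ε : ∀ ε → 0ℚ < ε → Σ ℚ λ s → 0ℚ < s × s < 1ℚ × s ≤ ε
∃0<s<1∧s≤ε ε 0<ε with ≤-total ε ½
... | inj₁ ε≤½ = ε , 0<ε , ≤-<-trans ε≤½ ½<1 , ≤-refl
... | inj₂ ½≤ε = ½ , positive⁻¹ ½ , ½<1 , ½≤ε

mainTheorem15 : (ε : ℚ) → Positive ε →
    Σ (Instance 2 2) λ I → Σ ℚ λ OPT → Σ ℚ λ ALG →
      IsMaxPayoffOver I AnyContract OPT × IsMaxPayoffOver I Separable ALG ×
      0ℚ < ALG × ((1ℚ + 1ℚ) - ε) * ALG ≤ OPT
mainTheorem15 ε ε>0 with ∃0<s<1∧s≤ε ε (positive⁻¹ ε {{ε>0}})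
... | s , 0<s , s<1 , s≤ε =
  gapInstance , 1ℚ - cost₁ , s , optimum , separableOptimum , 0<s , ratio
  where
  open GapInstance s 0<s s<1
  gap : ∀ ε s → (ε - s) * s ≡ (1ℚ - (1ℚ - s) * (1ℚ - s)) - ((1ℚ + 1ℚ) - ε) * s
  gap = solve-∀ ℚ-ring
  ratio : ((1ℚ + 1ℚ) - ε) * s ≤ 1ℚ - cost₁
  ratio = ≤-fromGap (0≤* (p≤q⇒0≤q-p s≤ε) 0≤s) (gap ε s)
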